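{- Let $G = (V,E)$ be a graph with $n$ vertices, $e$ edges, minimum degree $\delta \geq 1$, maximum degree $\Delta$, and independence number $\beta$. Then $$M_1(G) \leq (n - \beta)\Delta^2 + \frac{\bigl(e (\delta + n - \beta)\bigr)^2}{4 \delta (n - \beta) \beta},$$ with equality if and only if either $G$ is $K_{\beta,\, n - \beta}$, or $G$ is a bipartite graph with partition sets $I$ and $V - I$ such that $|I| = \beta$, $\delta < n - \beta$, $d(v) = \Delta$ for each vertex $v \in V - I$, and $I = P \cup Q$, where $P = \{x \in I : d(x) = n - \beta\}$, $Q = \{y \in I : d(y) = \delta\}$, $|P| = \frac{\delta \beta}{\delta + n - \beta}$ (an integer) and $|Q| = \frac{(n - \beta)\beta}{\delta + n - \beta}$ (an integer).
   Context: All graphs are finite, undirected, without loops or multiple edges. For a graph $G$, $d(u)$ denotes the degree of a vertex $u$, $\delta$ and $\Delta$ denote the minimum and maximum degree, and the first Zagreb index is $M_1(G) = \sum_{u \in V(G)} d^2(u)$. The independence number $\beta$ is the maximum size of a set of pairwise nonadjacent vertices. $K_{a,b}$ denotes the complete bipartite graph with parts of sizes $a$ and $b$. -}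

module Defs where

open import Data.Nat using (ℕ; zero; suc; _+_; _*_; _∸_; _^_; _≤_; _<_)
open import Data.Bool using (Bool; true; false; if_then_else_; _∧_)
open import Data.Fin using (Fin; toℕ) renaming (zero to fzero; suc to fsuc)
open import Data.Product using (Σ; _×_; ∃)
open import Data.Sum using (_⊎_)
open import Relation.Binary.PropositionalEquality using (_≡_; _≢_)
open import Relation.Nullary using (¬_)
open import Data.Nat using (_<ᵇ_)

sumFin : ∀ {n} → (Fin n → ℕ) → ℕ
sumFin {zero} f = 0
sumFin {suc n} f = f fzero + sumFin (λ i → f (fsuc i))

count : ∀ {n} → (Fin n → Bool) → ℕ
count p = sumFin (λ i → if p i then 1 else 0)

record Graph (n : ℕ) : Set where
  field
    adj   : Fin n → Fin n → Bool
    sym   : ∀ u v → adj u v ≡ adj v u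
    irrefl : ∀ u → adj u u ≡ false
open Graph public

VSet : ℕ → Set
VSet n = Fin n → Bool

deg : ∀ {n} → Graph n → Fin n → ℕ
deg G v = count (adj G v)

edges : ∀ {n} → Graph n → ℕ
edges G = sumFin (λ u → count (λ v → (toℕ u <ᵇ toℕ v) ∧ adj G u v))

M₁ : ∀ {n} → Graph n → ℕ
M₁ G = sumFin (λ v → deg G v ^ 2)

IsMinDegree : ∀ {n} → Graph n → ℕ → Set
IsMinDegree G δ = (∀ v → δ ≤ deg G v) × ∃ (λ v → deg G v ≡ δ)

IsMaxDegree : ∀ {n} → Graph n → ℕ → Set
IsMaxDegree G Δ = (∀ v → deg G v ≤ Δ) × ∃ (λ v → deg G v ≡ Δ)

Independent : ∀ {n} → Graph n → VSet n → Set
Independent G S = ∀ u v → S u ≡ true → S v ≡ true → adj G u v ≡ false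

IsIndependenceNumber : ∀ {n} → Graph n → ℕ → Set
IsIndependenceNumber G β =
  (Σ (VSet _) λ S → Independent G S × count S ≡ β) ×
  (∀ S → Independent G S → count S ≤ β)

BipartiteWith : ∀ {n} → Graph n → VSet n → Set
BipartiteWith G I = ∀ u v → adj G u v ≡ true → I u ≢ I v

IsCompleteBipartite : ∀ {n} → Graph n → ℕ → ℕ → Set
IsCompleteBipartite {n} G a b =
  Σ (VSet n) λ I → count I ≡ a × count (λ v → if I v then false else true) ≡ b ×
    (∀ u v → (adj G u v ≡ true → I u ≢ I v) × (I u ≢ I v → adj G u v ≡ true))

-- The second extremal family in Theorem 3 (with fractions cleared:
-- |P| (δ + n - β) = δβ  and  |Q| (δ + n - β) = (n - β) β).
SecondExtremal : ∀ {n} → Graph n → (δ Δ β : ℕ) → Set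
SecondExtremal {n} G δ Δ β =
  Σ (VSet n) λ I →
    BipartiteWith G I × count I ≡ β × δ < n ∸ β ×
    (∀ v → I v ≡ false → deg G v ≡ Δ) ×
    (∀ x → I x ≡ true → deg G x ≡ n ∸ β ⊎ deg G x ≡ δ) ×
    count (λ x → I x ∧ (deg G x Data.Nat.≡ᵇ (n ∸ β))) * (δ + (n ∸ β)) ≡ δ * β ×
    count (λ x → I x ∧ (deg G x Data.Nat.≡ᵇ δ)) * (δ + (n ∸ β)) ≡ (n ∸ β) * β

-- Let I be a maximum independent set and m = n ∸ β = |V − I|. Each x ∈ I has all its
-- neighbours in V − I, so δ ≤ d(x) ≤ m and hence d(x)² + δm + (d(x) − δ)(m − d(x)) = (δ + m) d(x).
-- Summing over I gives T + δmβ + S = (δ + m) s, where T = Σ_I d², s = Σ_I d and S ≥ 0 is the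
-- total slack; moreover s ≤ e because no edge has both ends in I. By AM-GM,
-- 4 δmβ T ≤ (δmβ + T + S)² = ((δ + m) s)² ≤ ((δ + m) e)², while the vertices of V − I
-- contribute at most m Δ² to M₁. Equality forces every step to be tight: degree Δ on V − I,
-- degrees in {m, δ} on I (S = 0), s = e (G bipartite with parts I, V − I) and T = δmβ;
-- counting the two kinds of degrees in I yields exactly the two extremal families.

module Submission where

open import Defs hiding (sym)
open import Data.Nat
open import Data.Nat.Properties
open import Data.Nat.Tactic.RingSolver using (solve-∀)
open import Data.Bool using (Bool; true; false; if_then_else_; _∧_)
open import Data.Bool.Properties using (T-≡)
open import Data.Fin using (Fin; toℕ) renaming (zero to fzero; suc to fsuc)
open import Data.Fin.Properties using (toℕ-injective) renaming (_≟_ to _≟ᶠ_)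
open import Data.Product
open import Data.Product.Function.NonDependent.Propositional using (_×-⇔_)
open import Data.Sum using (_⊎_; inj₁; inj₂)
import Data.Sum as ⊎
open import Data.Empty using (⊥; ⊥-elim)
open import Function.Base using (_∘_; id)
open import Function.Bundles using (_⇔_; mk⇔; Equivalence)
import Function.Properties.Equivalence as ⇔
open import Relation.Binary.PropositionalEquality
open import Relation.Binary.Definitions using (tri<; tri≈; tri>)
open import Relation.Nullary.Decidable using (dec-true)
open import Relation.Nullary using (yes; no; does)

true≢false : true ≢ false
true≢false ()

true-false⇒≢ : ∀ {b c} → b ≡ true → c ≡ false → b ≢ c
true-false⇒≢ b≡true c≡false b≡c = true≢false (trans (sym b≡true) (trans b≡c c≡false))

χ : Bool → ℕ
χ b = if b then 1 else 0

χ-mono : ∀ {x y} → (x ≡ true → y ≡ true) → χ x ≤ χ y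
χ-mono {false} h = z≤n
χ-mono {true} h rewrite h refl = ≤-refl

χ-injective : ∀ {x y} → χ x ≡ χ y → x ≡ y
χ-injective {false} {false} _ = refl
χ-injective {true} {true} _ = refl

sumFin-cong : ∀ {n} {f g : Fin n → ℕ} → (∀ i → f i ≡ g i) → sumFin f ≡ sumFin g
sumFin-cong {zero} h = refl
sumFin-cong {suc n} h = cong₂ _+_ (h fzero) (sumFin-cong (h ∘ fsuc))

sumFin-+ : ∀ {n} (f g : Fin n → ℕ) → sumFin (λ i → f i + g i) ≡ sumFin f + sumFin g
sumFin-+ {zero} f g = refl
sumFin-+ {suc n} f g rewrite sumFin-+ (f ∘ fsuc) (g ∘ fsuc) =
  interchange (f fzero) (g fzero) _ _
  where
  interchange : ∀ a b c d → a + b + (c + d) ≡ a + c + (b + d)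
  interchange = solve-∀

sumFin-*ˡ : ∀ {n} c (f : Fin n → ℕ) → sumFin (λ i → c * f i) ≡ c * sumFin f
sumFin-*ˡ {zero} c f = sym (*-zeroʳ c)
sumFin-*ˡ {suc n} c f rewrite sumFin-*ˡ c (f ∘ fsuc) = sym (*-distribˡ-+ c (f fzero) _)

sumFin-const : ∀ {n} c → sumFin {n} (λ _ → c) ≡ n * c
sumFin-const {zero} c = refl
sumFin-const {suc n} c = cong (c +_) (sumFin-const {n} c)

sumFin-zero : ∀ {n} → sumFin {n} (λ _ → 0) ≡ 0
sumFin-zero {n} = trans (sumFin-const {n} 0) (*-zeroʳ n)

sumFin-mono : ∀ {n} {f g : Fin n → ℕ} → (∀ i → f i ≤ g i) → sumFin f ≤ sumFin g
sumFin-mono {zero} h = ≤-refl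
sumFin-mono {suc n} h = +-mono-≤ (h fzero) (sumFin-mono (h ∘ fsuc))

sumFin-swap : ∀ {n k} (F : Fin n → Fin k → ℕ) →
  sumFin (λ u → sumFin (F u)) ≡ sumFin (λ v → sumFin (λ u → F u v))
sumFin-swap {zero} {k} F = sym (sumFin-zero {k})
sumFin-swap {suc n} F =
  trans (cong (sumFin (F fzero) +_) (sumFin-swap (F ∘ fsuc)))
        (sym (sumFin-+ (F fzero) (λ v → sumFin (λ u → F (fsuc u) v))))

+-mono-≤-≡⇒≡ : ∀ {a b c d} → a ≤ c → b ≤ d → a + b ≡ c + d → a ≡ c × b ≡ d
+-mono-≤-≡⇒≡ {a} {b} {c} {d} a≤c b≤d eq = a≡c , +-cancelˡ-≡ a b d (trans eq (cong (_+ d) (sym a≡c)))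
  where
  a≡c : a ≡ c
  a≡c = ≤-antisym a≤c (+-cancelʳ-≤ b c a (≤-trans (+-monoʳ-≤ c b≤d) (≤-reflexive (sym eq))))

sumFin-mono-≡⇒≗ : ∀ {n} {f g : Fin n → ℕ} → (∀ i → f i ≤ g i) → sumFin f ≡ sumFin g → ∀ i → f i ≡ g i
sumFin-mono-≡⇒≗ {suc n} f≤g eq fzero = proj₁ (+-mono-≤-≡⇒≡ (f≤g fzero) (sumFin-mono (f≤g ∘ fsuc)) eq)
sumFin-mono-≡⇒≗ {suc n} f≤g eq (fsuc i) =
  sumFin-mono-≡⇒≗ (f≤g ∘ fsuc) (proj₂ (+-mono-≤-≡⇒≡ (f≤g fzero) (sumFin-mono (f≤g ∘ fsuc)) eq)) i

sumFin² : ∀ {n k} → (Fin n → Fin k → ℕ) → ℕ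
sumFin² F = sumFin (λ u → sumFin (F u))

sumFin²-+ : ∀ {n k} (f g : Fin n → Fin k → ℕ) →
  sumFin² (λ u v → f u v + g u v) ≡ sumFin² f + sumFin² g
sumFin²-+ f g = trans (sumFin-cong (λ u → sumFin-+ (f u) (g u))) (sumFin-+ (λ u → sumFin (f u)) (λ u → sumFin (g u)))

sumFin²-mono-≡⇔≗ : ∀ {n k} {f g : Fin n → Fin k → ℕ} → (∀ u v → f u v ≤ g u v) →
  (sumFin² f ≡ sumFin² g ⇔ (∀ u v → f u v ≡ g u v))
sumFin²-mono-≡⇔≗ f≤g = mk⇔
  (λ eq u → sumFin-mono-≡⇒≗ (f≤g u) (sumFin-mono-≡⇒≗ (λ u → sumFin-mono (f≤g u)) eq u))
  (λ f≗g → sumFin-cong (λ u → sumFin-cong (f≗g u)))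

count-positive : ∀ {n} (p : Fin n → Bool) w → p w ≡ true → 0 < count p
count-positive p fzero pw rewrite pw = s≤s z≤n
count-positive p (fsuc w) pw = ≤-trans (count-positive (p ∘ fsuc) w pw) (m≤n+m _ (χ (p fzero)))

count-witness : ∀ {n} (p : Fin n → Bool) → 0 < count p → ∃ λ w → p w ≡ true
count-witness {suc n} p pos with p fzero in e
... | true = fzero , e
... | false = let w , pw = count-witness (p ∘ fsuc) pos in fsuc w , pw

count-mono : ∀ {n} {p q : Fin n → Bool} → (∀ i → p i ≡ true → q i ≡ true) → count p ≤ count q
count-mono p⊆q = sumFin-mono (λ i → χ-mono (p⊆q i))

count-mono-≡⇒⊇ : ∀ {n} {p q : Fin n → Bool} → (∀ i → p i ≡ true → q i ≡ true) → count p ≡ count q →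
  ∀ i → q i ≡ true → p i ≡ true
count-mono-≡⇒⊇ p⊆q eq i qi =
  trans (χ-injective (sumFin-mono-≡⇒≗ (λ j → χ-mono (p⊆q j)) eq i)) qi

compl : ∀ {n} → VSet n → VSet n
compl I v = if I v then false else true

compl-true : ∀ {n} (I : VSet n) v → I v ≡ false → compl I v ≡ true
compl-true I v Iv rewrite Iv = refl

compl-true⁻¹ : ∀ {n} (I : VSet n) v → compl I v ≡ true → I v ≡ false
compl-true⁻¹ I v c with I v
... | false = refl

count-compl : ∀ {n} (I : VSet n) {β} → count I ≡ β → count (compl I) ≡ n ∸ β
count-compl {n} I {β} refl = sym (trans (cong (_∸ count I) (sym partition)) (m+n∸m≡n (count I) _))
  where
  partition : count I + count (compl I) ≡ n
  partition = begin
    count I + count (compl I)                   ≡⟨ sumFin-+ (χ ∘ I) (χ ∘ compl I) ⟨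
    sumFin (λ v → χ (I v) + χ (compl I v))      ≡⟨ sumFin-cong χ+χ-compl ⟩
    sumFin {n} (λ _ → 1)                        ≡⟨ sumFin-const {n} 1 ⟩
    n * 1                                       ≡⟨ *-identityʳ n ⟩
    n                                           ∎
    where
    open ≡-Reasoning
    χ+χ-compl : ∀ v → χ (I v) + χ (compl I v) ≡ 1
    χ+χ-compl v with I v
    ... | true = refl
    ... | false = refl

inside : ∀ {n} → VSet n → (Fin n → ℕ) → Fin n → ℕ
inside I f u = if I u then f u else 0

sumFin-inside+compl : ∀ {n} (I : VSet n) (f : Fin n → ℕ) →
  sumFin f ≡ sumFin (inside I f) + sumFin (inside (compl I) f)
sumFin-inside+compl I f = trans (sumFin-cong split) (sumFin-+ (inside I f) (inside (compl I) f))
  where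
  split : ∀ v → f v ≡ inside I f v + inside (compl I) f v
  split v with I v
  ... | true = sym (+-identityʳ _)
  ... | false = refl

sumFin-inside-cong : ∀ {n} (I : VSet n) {f g : Fin n → ℕ} → (∀ v → I v ≡ true → f v ≡ g v) →
  sumFin (inside I f) ≡ sumFin (inside I g)
sumFin-inside-cong I {f} {g} f≡g = sumFin-cong pointwise
  where
  pointwise : ∀ v → inside I f v ≡ inside I g v
  pointwise v with I v in e
  ... | true = f≡g v e
  ... | false = refl

sumFin-inside-const : ∀ {n} (I : VSet n) c → sumFin (inside I (λ _ → c)) ≡ c * count I
sumFin-inside-const I c = trans (sumFin-cong c*χ) (sumFin-*ˡ c (χ ∘ I))
  where
  c*χ : ∀ v → inside I (λ _ → c) v ≡ c * χ (I v)
  c*χ v with I v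
  ... | true = sym (*-identityʳ c)
  ... | false = sym (*-zeroʳ c)

≡ᵇ-true : ∀ {a b} → a ≡ b → (a ≡ᵇ b) ≡ true
≡ᵇ-true {a} {b} a≡b = Equivalence.to T-≡ (≡⇒≡ᵇ a b a≡b)

≡ᵇ-false : ∀ {a b} → a ≢ b → (a ≡ᵇ b) ≡ false
≡ᵇ-false {a} {b} a≢b with a ≡ᵇ b in eq
... | true = ⊥-elim (a≢b (≡ᵇ⇒≡ a b (Equivalence.from T-≡ eq)))
... | false = refl

sumFin-inside-two-valued : ∀ {n} (I : VSet n) (d : Fin n → ℕ) {a b} → a ≢ b →
  (∀ x → I x ≡ true → d x ≡ a ⊎ d x ≡ b) → (h : ℕ → ℕ) →
  sumFin (inside I (λ x → h (d x))) ≡ h a * count (λ x → I x ∧ (d x ≡ᵇ a)) + h b * count (λ x → I x ∧ (d x ≡ᵇ b))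
sumFin-inside-two-valued I d {a} {b} a≢b two-valued h = begin
  sumFin (inside I (λ x → h (d x)))
    ≡⟨ sumFin-cong pointwise ⟩
  sumFin (λ x → h a * χ (I x ∧ (d x ≡ᵇ a)) + h b * χ (I x ∧ (d x ≡ᵇ b)))
    ≡⟨ sumFin-+ (λ x → h a * χ (I x ∧ (d x ≡ᵇ a))) (λ x → h b * χ (I x ∧ (d x ≡ᵇ b))) ⟩
  sumFin (λ x → h a * χ (I x ∧ (d x ≡ᵇ a))) + sumFin (λ x → h b * χ (I x ∧ (d x ≡ᵇ b)))
    ≡⟨ cong₂ _+_ (sumFin-*ˡ (h a) (λ x → χ (I x ∧ (d x ≡ᵇ a)))) (sumFin-*ˡ (h b) (λ x → χ (I x ∧ (d x ≡ᵇ b)))) ⟩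
  h a * count (λ x → I x ∧ (d x ≡ᵇ a)) + h b * count (λ x → I x ∧ (d x ≡ᵇ b)) ∎
  where
  open ≡-Reasoning
  pointwise : ∀ x → inside I (λ x → h (d x)) x ≡ h a * χ (I x ∧ (d x ≡ᵇ a)) + h b * χ (I x ∧ (d x ≡ᵇ b))
  pointwise x with I x in Ix
  ... | false = sym (cong₂ _+_ (*-zeroʳ (h a)) (*-zeroʳ (h b)))
  ... | true with two-valued x Ix
  ... | inj₁ refl rewrite ≡ᵇ-true {d x} refl | ≡ᵇ-false a≢b =
    sym (trans (cong₂ _+_ (*-identityʳ (h a)) (*-zeroʳ (h b))) (+-identityʳ (h a)))
  ... | inj₂ refl rewrite ≡ᵇ-true {d x} refl | ≡ᵇ-false (a≢b ∘ sym) =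
    sym (cong₂ _+_ (*-zeroʳ (h a)) (*-identityʳ (h b)))

x^2≡x*x : ∀ x → x ^ 2 ≡ x * x
x^2≡x*x x = cong (x *_) (*-identityʳ x)

x^2≡y^2⇒x≡y : ∀ {x y} → x ^ 2 ≡ y ^ 2 → x ≡ y
x^2≡y^2⇒x≡y {x} {y} eq with <-cmp x y
... | tri< x<y _ _ = ⊥-elim (<-irrefl eq (^-monoˡ-< 2 x<y))
... | tri≈ _ x≡y _ = x≡y
... | tri> _ _ y<x = ⊥-elim (<-irrefl (sym eq) (^-monoˡ-< 2 y<x))

≤-≤-≡⇒≡ : ∀ {a b c} → a ≤ b → b ≤ c → a ≡ c → a ≡ b × b ≡ c
≤-≤-≡⇒≡ a≤b b≤c refl = ≤-antisym a≤b b≤c , ≤-antisym b≤c a≤b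

am-gm : ∀ y z → 4 * y * z + ∣ y - z ∣ ^ 2 ≡ (y + z) ^ 2
am-gm y z with ≤-total y z
... | inj₁ y≤z with k , refl ← m≤n⇒∃[o]m+o≡n y≤z
  rewrite ∣m-m+n∣≡n y k | x^2≡x*x k | x^2≡x*x (y + (y + k)) = identity y k
  where
  identity : ∀ y k → 4 * y * (y + k) + k * k ≡ (y + (y + k)) * (y + (y + k))
  identity = solve-∀
... | inj₂ z≤y with k , refl ← m≤n⇒∃[o]m+o≡n z≤y
  rewrite ∣-∣-comm (z + k) z | ∣m-m+n∣≡n z k | x^2≡x*x k | x^2≡x*x (z + k + z) = identity z k
  where
  identity : ∀ z k → 4 * (z + k) * z + k * k ≡ (z + k + z) * (z + k + z)
  identity = solve-∀

am-gm-≤ : ∀ y z → 4 * y * z ≤ (y + z) ^ 2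
am-gm-≤ y z = ≤-trans (m≤m+n _ _) (≤-reflexive (am-gm y z))

am-gm-≡⇒≡ : ∀ {y z} → 4 * y * z ≡ (y + z) ^ 2 → y ≡ z
am-gm-≡⇒≡ {y} {z} eq = ∣m-n∣≡0⇒m≡n (m^n≡0⇒m≡0 _ 2 gap≡0)
  where
  gap≡0 : ∣ y - z ∣ ^ 2 ≡ 0
  gap≡0 = +-cancelˡ-≡ (4 * y * z) _ 0 (trans (am-gm y z) (trans (sym eq) (sym (+-identityʳ _))))

slack-identity : ∀ δ m d → δ ≤ d → d ≤ m → d ^ 2 + δ * m + (d ∸ δ) * (m ∸ d) ≡ (δ + m) * d
slack-identity δ m d δ≤d d≤m with p , refl ← m≤n⇒∃[o]m+o≡n δ≤d | q , refl ← m≤n⇒∃[o]m+o≡n d≤m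
  rewrite m+n∸m≡n δ p | m+n∸m≡n (δ + p) q | x^2≡x*x (δ + p) = identity δ p q
  where
  identity : ∀ δ p q → (δ + p) * (δ + p) + δ * (δ + p + q) + p * q ≡ (δ + (δ + p + q)) * (δ + p)
  identity = solve-∀

slack≡0⇔ : ∀ {δ m d} → δ ≤ d → d ≤ m → ((d ∸ δ) * (m ∸ d) ≡ 0 ⇔ (d ≡ m ⊎ d ≡ δ))
slack≡0⇔ {δ} {m} {d} δ≤d d≤m = mk⇔ to from
  where
  to : (d ∸ δ) * (m ∸ d) ≡ 0 → d ≡ m ⊎ d ≡ δ
  to eq with m*n≡0⇒m≡0∨n≡0 (d ∸ δ) eq
  ... | inj₁ d∸δ≡0 = inj₂ (≤-antisym (m∸n≡0⇒m≤n d∸δ≡0) δ≤d)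
  ... | inj₂ m∸d≡0 = inj₁ (≤-antisym d≤m (m∸n≡0⇒m≤n m∸d≡0))
  from : d ≡ m ⊎ d ≡ δ → (d ∸ δ) * (m ∸ d) ≡ 0
  from (inj₁ refl) = trans (cong ((d ∸ δ) *_) (n∸n≡0 d)) (*-zeroʳ (d ∸ δ))
  from (inj₂ refl) = cong (_* (m ∸ d)) (n∸n≡0 d)

rearrangement-≡⇒-≤ : ∀ {x y a b} → x ≤ y → a ≤ b → x * a + y * b ≡ x * b + y * a → x ≡ y ⊎ a ≡ b
rearrangement-≡⇒-≤ {x} {_} {a} x≤y a≤b eq with p , refl ← m≤n⇒∃[o]m+o≡n x≤y | q , refl ← m≤n⇒∃[o]m+o≡n a≤b =
  ⊎.map (λ p≡0 → sym (trans (cong (x +_) p≡0) (+-identityʳ x)))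
        (λ q≡0 → sym (trans (cong (a +_) q≡0) (+-identityʳ a)))
        (m*n≡0⇒m≡0∨n≡0 p (+-cancelˡ-≡ _ _ 0 (trans (sym (expand x p a q)) (trans eq (sym (+-identityʳ _))))))
  where
  expand : ∀ x p a q → x * a + (x + p) * (a + q) ≡ x * (a + q) + (x + p) * a + p * q
  expand = solve-∀

rearrangement-≡⇒ : ∀ x y a b → x * a + y * b ≡ x * b + y * a → x ≡ y ⊎ a ≡ b
rearrangement-≡⇒ x y a b eq with ≤-total x y | ≤-total a b
... | inj₁ x≤y | inj₁ a≤b = rearrangement-≡⇒-≤ x≤y a≤b eq
... | inj₁ x≤y | inj₂ b≤a = ⊎.map₂ sym (rearrangement-≡⇒-≤ x≤y b≤a (sym eq))
... | inj₂ y≤x | inj₁ a≤b = ⊎.map₁ sym (rearrangement-≡⇒-≤ y≤x a≤b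
  (trans (+-comm (y * a) (x * b)) (trans (sym eq) (+-comm (x * a) (y * b)))))
... | inj₂ y≤x | inj₂ b≤a = ⊎.map sym sym (rearrangement-≡⇒-≤ y≤x b≤a
  (trans (+-comm (y * b) (x * a)) (trans eq (+-comm (x * b) (y * a)))))

balance⇒counts : ∀ {δ m β P Q} → m ≢ δ → P + Q ≡ β → (δ + m) * (m * P + δ * Q) ≡ 2 * (δ * m * β) →
  P * (δ + m) ≡ δ * β × Q * (δ + m) ≡ m * β
balance⇒counts {δ} {m} {_} {P} {Q} m≢δ refl balance with rearrangement-≡⇒ (m * P) (δ * Q) m δ rearranged
  where
  lhs : ∀ δ m P Q → (δ + m) * (m * P + δ * Q) ≡ (m * P * δ + δ * Q * m) + (m * P * m + δ * Q * δ)
  lhs = solve-∀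
  rhs : ∀ δ m P Q → 2 * (δ * m * (P + Q)) ≡ (m * P * δ + δ * Q * m) + (m * P * δ + δ * Q * m)
  rhs = solve-∀
  rearranged : m * P * m + δ * Q * δ ≡ m * P * δ + δ * Q * m
  rearranged = +-cancelˡ-≡ (m * P * δ + δ * Q * m) _ _ (trans (sym (lhs δ m P Q)) (trans balance (rhs δ m P Q)))
... | inj₂ m≡δ = ⊥-elim (m≢δ m≡δ)
... | inj₁ mP≡δQ = P-count , Q-count
  where
  P-count : P * (δ + m) ≡ δ * (P + Q)
  P-count = begin
    P * (δ + m)      ≡⟨ *-distribˡ-+ P δ m ⟩
    P * δ + P * m    ≡⟨ cong₂ _+_ (*-comm P δ) (trans (*-comm P m) mP≡δQ) ⟩
    δ * P + δ * Q    ≡⟨ *-distribˡ-+ δ P Q ⟨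
    δ * (P + Q)      ∎
    where open ≡-Reasoning
  Q-count : Q * (δ + m) ≡ m * (P + Q)
  Q-count = begin
    Q * (δ + m)      ≡⟨ *-distribˡ-+ Q δ m ⟩
    Q * δ + Q * m    ≡⟨ cong₂ _+_ (trans (*-comm Q δ) (sym mP≡δQ)) (*-comm Q m) ⟩
    m * P + m * Q    ≡⟨ *-distribˡ-+ m P Q ⟨
    m * (P + Q)      ∎
    where open ≡-Reasoning

counts⇒balance : ∀ {δ m β P Q} → P * (δ + m) ≡ δ * β → Q * (δ + m) ≡ m * β →
  (δ + m) * (m * P + δ * Q) ≡ 2 * (δ * m * β)
counts⇒balance {δ} {m} {β} {P} {Q} P-count Q-count = begin
  (δ + m) * (m * P + δ * Q)          ≡⟨ distribute δ m P Q ⟩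
  m * (P * (δ + m)) + δ * (Q * (δ + m)) ≡⟨ cong₂ (λ p q → m * p + δ * q) P-count Q-count ⟩
  m * (δ * β) + δ * (m * β)          ≡⟨ collect δ m β ⟩
  2 * (δ * m * β)                    ∎
  where
  open ≡-Reasoning
  distribute : ∀ δ m P Q → (δ + m) * (m * P + δ * Q) ≡ m * (P * (δ + m)) + δ * (Q * (δ + m))
  distribute = solve-∀
  collect : ∀ δ m β → m * (δ * β) + δ * (m * β) ≡ 2 * (δ * m * β)
  collect = solve-∀

module ZagrebArithmetic {δ m β Δ e s T A S : ℕ}
  (A≤mΔ² : A ≤ m * Δ ^ 2) (balance : T + δ * m * β + S ≡ (δ + m) * s) (s≤e : s ≤ e) where

  Y : ℕ
  Y = δ * m * β

  K*[T+A]≡ : 4 * δ * m * β * (T + A) ≡ 4 * δ * m * β * A + 4 * Y * T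
  K*[T+A]≡ = identity δ m β T A
    where
    identity : ∀ δ m β T A → 4 * δ * m * β * (T + A) ≡ 4 * δ * m * β * A + 4 * (δ * m * β) * T
    identity = solve-∀

  Y+[T+S]≡ : Y + (T + S) ≡ (δ + m) * s
  Y+[T+S]≡ = trans (reorder Y T S) balance
    where
    reorder : ∀ Y T S → Y + (T + S) ≡ T + Y + S
    reorder = solve-∀

  drop-S : 4 * Y * T ≤ 4 * Y * (T + S)
  drop-S = *-monoʳ-≤ (4 * Y) (m≤m+n T S)

  apply-am-gm : 4 * Y * (T + S) ≤ ((δ + m) * s) ^ 2
  apply-am-gm = subst (λ x → 4 * Y * (T + S) ≤ x ^ 2) Y+[T+S]≡ (am-gm-≤ Y (T + S))

  raise-s : ((δ + m) * s) ^ 2 ≤ (e * (δ + m)) ^ 2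
  raise-s = ^-monoˡ-≤ 2 (subst ((δ + m) * s ≤_) (*-comm (δ + m) e) (*-monoʳ-≤ (δ + m) s≤e))

  4YT≤ : 4 * Y * T ≤ (e * (δ + m)) ^ 2
  4YT≤ = ≤-trans drop-S (≤-trans apply-am-gm raise-s)

  bound : 4 * δ * m * β * (T + A) ≤ 4 * δ * m * β * (m * Δ ^ 2) + (e * (δ + m)) ^ 2
  bound = begin
    4 * δ * m * β * (T + A)          ≡⟨ K*[T+A]≡ ⟩
    4 * δ * m * β * A + 4 * Y * T    ≤⟨ +-mono-≤ (*-monoʳ-≤ (4 * δ * m * β) A≤mΔ²) 4YT≤ ⟩
    4 * δ * m * β * (m * Δ ^ 2) + (e * (δ + m)) ^ 2 ∎
    where open ≤-Reasoning

  bound-≡⇔ : .{{_ : NonZero δ}} .{{_ : NonZero m}} .{{_ : NonZero β}} →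
    (4 * δ * m * β * (T + A) ≡ 4 * δ * m * β * (m * Δ ^ 2) + (e * (δ + m)) ^ 2)
      ⇔ (A ≡ m * Δ ^ 2 × S ≡ 0 × s ≡ e × (δ + m) * s ≡ 2 * Y)
  bound-≡⇔ = mk⇔ to from
    where
    instance
      4Y≢0 : NonZero (4 * Y)
      4Y≢0 = m*n≢0 4 Y {{_}} {{m*n≢0 (δ * m) β {{m*n≢0 δ m}}}}
      K≢0 : NonZero (4 * δ * m * β)
      K≢0 = m*n≢0 (4 * δ * m) β {{m*n≢0 (4 * δ) m {{m*n≢0 4 δ}}}}
      δ+m≢0 : NonZero (δ + m)
      δ+m≢0 = >-nonZero (<-≤-trans (>-nonZero⁻¹ δ) (m≤m+n δ m))
    to : 4 * δ * m * β * (T + A) ≡ 4 * δ * m * β * (m * Δ ^ 2) + (e * (δ + m)) ^ 2 →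
         A ≡ m * Δ ^ 2 × S ≡ 0 × s ≡ e × (δ + m) * s ≡ 2 * Y
    to eq = A≡ , S≡0 , s≡e , balanced
      where
      parts : 4 * δ * m * β * A ≡ 4 * δ * m * β * (m * Δ ^ 2) × 4 * Y * T ≡ (e * (δ + m)) ^ 2
      parts = +-mono-≤-≡⇒≡ (*-monoʳ-≤ (4 * δ * m * β) A≤mΔ²) 4YT≤ (trans (sym K*[T+A]≡) eq)
      A≡ : A ≡ m * Δ ^ 2
      A≡ = *-cancelˡ-≡ A _ (4 * δ * m * β) (proj₁ parts)
      drop-S≡ : 4 * Y * T ≡ 4 * Y * (T + S) × 4 * Y * (T + S) ≡ (e * (δ + m)) ^ 2
      drop-S≡ = ≤-≤-≡⇒≡ drop-S (≤-trans apply-am-gm raise-s) (proj₂ parts)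
      am-gm≡ : 4 * Y * (T + S) ≡ ((δ + m) * s) ^ 2 × ((δ + m) * s) ^ 2 ≡ (e * (δ + m)) ^ 2
      am-gm≡ = ≤-≤-≡⇒≡ apply-am-gm raise-s (proj₂ drop-S≡)
      S≡0 : S ≡ 0
      S≡0 = +-cancelˡ-≡ T S 0 (trans (sym (*-cancelˡ-≡ T (T + S) (4 * Y) (proj₁ drop-S≡))) (sym (+-identityʳ T)))
      Y≡T+S : Y ≡ T + S
      Y≡T+S = am-gm-≡⇒≡ (trans (proj₁ am-gm≡) (cong (_^ 2) (sym Y+[T+S]≡)))
      s≡e : s ≡ e
      s≡e = *-cancelˡ-≡ s e (δ + m) (trans (x^2≡y^2⇒x≡y (proj₂ am-gm≡)) (*-comm e (δ + m)))
      balanced : (δ + m) * s ≡ 2 * Y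
      balanced = trans (sym Y+[T+S]≡) (trans (cong (Y +_) (sym Y≡T+S)) (cong (Y +_) (sym (+-identityʳ Y))))
    from : A ≡ m * Δ ^ 2 × S ≡ 0 × s ≡ e × (δ + m) * s ≡ 2 * Y →
           4 * δ * m * β * (T + A) ≡ 4 * δ * m * β * (m * Δ ^ 2) + (e * (δ + m)) ^ 2
    from (A≡ , S≡0 , s≡e , balanced) = begin
      4 * δ * m * β * (T + A)                            ≡⟨ K*[T+A]≡ ⟩
      4 * δ * m * β * A + 4 * Y * T                      ≡⟨ cong₂ (λ a t → 4 * δ * m * β * a + 4 * Y * t) A≡ T≡Y ⟩
      4 * δ * m * β * (m * Δ ^ 2) + 4 * Y * Y            ≡⟨ cong (4 * δ * m * β * (m * Δ ^ 2) +_) 4YY≡[2Y]² ⟩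
      4 * δ * m * β * (m * Δ ^ 2) + (2 * Y) ^ 2          ≡⟨ cong (λ x → 4 * δ * m * β * (m * Δ ^ 2) + x ^ 2) 2Y≡e[δ+m] ⟩
      4 * δ * m * β * (m * Δ ^ 2) + (e * (δ + m)) ^ 2    ∎
      where
      open ≡-Reasoning
      2Y≡e[δ+m] : 2 * Y ≡ e * (δ + m)
      2Y≡e[δ+m] = trans (sym balanced) (trans (cong ((δ + m) *_) s≡e) (*-comm (δ + m) e))
      T≡Y : T ≡ Y
      T≡Y = +-cancelˡ-≡ Y T Y (begin
        Y + T         ≡⟨ +-identityʳ (Y + T) ⟨
        Y + T + 0     ≡⟨ cong (Y + T +_) S≡0 ⟨
        Y + T + S     ≡⟨ +-assoc Y T S ⟩
        Y + (T + S)   ≡⟨ trans Y+[T+S]≡ balanced ⟩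
        Y + (Y + 0)   ≡⟨ cong (Y +_) (+-identityʳ Y) ⟩
        Y + Y         ∎)
      4YY≡[2Y]² : 4 * Y * Y ≡ (2 * Y) ^ 2
      4YY≡[2Y]² = trans (identity Y) (sym (x^2≡x*x (2 * Y)))
        where
        identity : ∀ Y → 4 * Y * Y ≡ 2 * Y * (2 * Y)
        identity = solve-∀

_≺_ : ∀ {n} → Fin n → Fin n → Bool
u ≺ v = toℕ u <ᵇ toℕ v

<ᵇ-trichotomy : ∀ a b → ((a <ᵇ b) ≡ true × (b <ᵇ a) ≡ false) ⊎ ((a <ᵇ b) ≡ false × (b <ᵇ a) ≡ true) ⊎ a ≡ b
<ᵇ-trichotomy zero zero = inj₂ (inj₂ refl)
<ᵇ-trichotomy zero (suc b) = inj₁ (refl , refl)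
<ᵇ-trichotomy (suc a) zero = inj₂ (inj₁ (refl , refl))
<ᵇ-trichotomy (suc a) (suc b) = ⊎.map₂ (⊎.map₂ (cong suc)) (<ᵇ-trichotomy a b)

≺-trichotomy : ∀ {n} (u v : Fin n) → ((u ≺ v) ≡ true × (v ≺ u) ≡ false) ⊎ ((u ≺ v) ≡ false × (v ≺ u) ≡ true) ⊎ u ≡ v
≺-trichotomy u v = ⊎.map₂ (⊎.map₂ toℕ-injective) (<ᵇ-trichotomy (toℕ u) (toℕ v))

sumFin²-ordered-pairs : ∀ {n} (F : Fin n → Fin n → ℕ) → (∀ u → F u u ≡ 0) →
  sumFin² F ≡ sumFin² (λ u v → χ (u ≺ v) * (F u v + F v u))
sumFin²-ordered-pairs {n} F F-diag = begin
  sumFin² F                                         ≡⟨ sumFin-cong (λ u → sumFin-cong (by-order u)) ⟩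
  sumFin² (λ u v → forward u v + backward u v)      ≡⟨ sumFin²-+ forward backward ⟩
  sumFin² forward + sumFin² backward                ≡⟨ cong (sumFin² forward +_) (sumFin-swap backward) ⟩
  sumFin² forward + sumFin² (λ u v → backward v u)  ≡⟨ sumFin²-+ forward (λ u v → backward v u) ⟨
  sumFin² (λ u v → forward u v + backward v u)
    ≡⟨ sumFin-cong (λ u → sumFin-cong (λ v → *-distribˡ-+ (χ (u ≺ v)) (F u v) (F v u))) ⟨
  sumFin² (λ u v → χ (u ≺ v) * (F u v + F v u))     ∎
  where
  open ≡-Reasoning
  forward backward : Fin n → Fin n → ℕ
  forward u v = χ (u ≺ v) * F u v
  backward u v = χ (v ≺ u) * F u v
  by-order : ∀ u v → F u v ≡ forward u v + backward u v
  by-order u v with ≺-trichotomy u v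
  ... | inj₁ (u≺v , v⊀u) rewrite u≺v | v⊀u = sym (trans (+-identityʳ _) (+-identityʳ _))
  ... | inj₂ (inj₁ (u⊀v , v≺u)) rewrite u⊀v | v≺u = sym (+-identityʳ _)
  ... | inj₂ (inj₂ refl) rewrite F-diag u = sym (cong₂ _+_ (*-zeroʳ (χ (u ≺ u))) (*-zeroʳ (χ (u ≺ u))))

χ-pair-≤ : ∀ l x y a → (a ≡ true → x ≡ true → y ≡ true → ⊥) →
  χ l * (χ (x ∧ a) + χ (y ∧ a)) ≤ χ (l ∧ a)
χ-pair-≤ false x y a _ = z≤n
χ-pair-≤ true true true true both = ⊥-elim (both refl refl refl)
χ-pair-≤ true true false true _ = ≤-refl
χ-pair-≤ true false true true _ = ≤-refl
χ-pair-≤ true false false true _ = z≤n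
χ-pair-≤ true true true false _ = z≤n
χ-pair-≤ true true false false _ = z≤n
χ-pair-≤ true false true false _ = z≤n
χ-pair-≤ true false false false _ = z≤n

χ-pair-≡⇔ : ∀ l x y a →
  (χ l * (χ (x ∧ a) + χ (y ∧ a)) ≡ χ (l ∧ a)) ⇔ (l ≡ true → a ≡ true → x ≢ y)
χ-pair-≡⇔ l x y a = mk⇔ (to l x y a) (from l x y a)
  where
  to : ∀ l x y a → χ l * (χ (x ∧ a) + χ (y ∧ a)) ≡ χ (l ∧ a) → l ≡ true → a ≡ true → x ≢ y
  to true true true true () refl refl refl
  to true false false true () refl refl refl
  from : ∀ l x y a → (l ≡ true → a ≡ true → x ≢ y) → χ l * (χ (x ∧ a) + χ (y ∧ a)) ≡ χ (l ∧ a)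
  from false x y a _ = refl
  from true true true true x≢y = ⊥-elim (x≢y refl refl refl)
  from true false false true x≢y = ⊥-elim (x≢y refl refl refl)
  from true true false true _ = refl
  from true false true true _ = refl
  from true true true false _ = refl
  from true true false false _ = refl
  from true false true false _ = refl
  from true false false false _ = refl

module _ {n} (G : Graph n) where

  bipartite⇔ordered : ∀ (I : VSet n) →
    BipartiteWith G I ⇔ (∀ u v → (u ≺ v) ≡ true → adj G u v ≡ true → I u ≢ I v)
  bipartite⇔ordered I = mk⇔ (λ bip u v _ → bip u v) from
    where
    from : _ → BipartiteWith G I
    from ordered u v uv with ≺-trichotomy u v
    ... | inj₁ (u≺v , _) = ordered u v u≺v uv
    ... | inj₂ (inj₁ (_ , v≺u)) = ordered v u v≺u (trans (Graph.sym G v u) uv) ∘ sym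
    ... | inj₂ (inj₂ refl) = ⊥-elim (true≢false (trans (sym uv) (irrefl G u)))

  bipartite⇒same-side-nonadjacent : ∀ {I} → BipartiteWith G I → ∀ u v → I u ≡ I v → adj G u v ≡ false
  bipartite⇒same-side-nonadjacent bip u v same with adj G u v in uv
  ... | true = ⊥-elim (bip u v uv same)
  ... | false = refl

  bipartite⇒independent : ∀ {I} → BipartiteWith G I → Independent G I
  bipartite⇒independent bip u v Iu Iv = bipartite⇒same-side-nonadjacent bip u v (trans Iu (sym Iv))

  independent⇒neighbours⊆compl : ∀ {I} → Independent G I → ∀ {x} → I x ≡ true →
    ∀ v → adj G x v ≡ true → compl I v ≡ true
  independent⇒neighbours⊆compl {I} indep {x} Ix v xv with I v in Iv
  ... | false = refl
  ... | true with () ← trans (sym xv) (indep x v Ix Iv)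

  independent⇒deg≤n∸|I| : ∀ {I β} → Independent G I → count I ≡ β → ∀ {x} → I x ≡ true → deg G x ≤ n ∸ β
  independent⇒deg≤n∸|I| {I} indep |I|≡β Ix =
    subst (deg G _ ≤_) (count-compl I |I|≡β) (count-mono (independent⇒neighbours⊆compl indep Ix))

  independence-number-positive : ∀ {β} → IsIndependenceNumber G β → Fin n → 0 < β
  independence-number-positive (_ , maximal) w =
    ≤-trans (count-positive ｛w｝ w (dec-true (w ≟ᶠ w) refl)) (maximal ｛w｝ ｛w｝-independent)
    where
    ｛w｝ : VSet n
    ｛w｝ u = does (u ≟ᶠ w)
    ∈｛w｝⇒≡ : ∀ {u} → ｛w｝ u ≡ true → u ≡ w
    ∈｛w｝⇒≡ {u} eq with u ≟ᶠ w
    ... | yes u≡w = u≡w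
    ｛w｝-independent : Independent G ｛w｝
    ｛w｝-independent u v u∈ v∈ = subst₂ (λ a b → adj G a b ≡ false) (sym (∈｛w｝⇒≡ u∈)) (sym (∈｛w｝⇒≡ v∈)) (irrefl G w)

  independent⇒count-compl-positive : ∀ {I} → Independent G I → ∀ w → 0 < deg G w → 0 < count (compl I)
  independent⇒count-compl-positive {I} indep w deg>0 with I w in Iw
  ... | false = count-positive (compl I) w (compl-true I w Iw)
  ... | true = let u , wu = count-witness (adj G w) deg>0 in
    count-positive (compl I) u (independent⇒neighbours⊆compl indep Iw u wu)

  module _ (I : VSet n) where

    ends-in : Fin n → Fin n → ℕ
    ends-in u v = χ (u ≺ v) * (χ (I u ∧ adj G u v) + χ (I v ∧ adj G u v))

    degree-sum≡sumFin²-ends-in : sumFin (inside I (deg G)) ≡ sumFin² ends-in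
    degree-sum≡sumFin²-ends-in = begin
      sumFin (inside I (deg G))                                ≡⟨ sumFin-cong as-row ⟩
      sumFin² (λ u v → χ (I u ∧ adj G u v))                    ≡⟨ sumFin²-ordered-pairs (λ u v → χ (I u ∧ adj G u v)) diagonal ⟩
      sumFin² (λ u v → χ (u ≺ v) * (χ (I u ∧ adj G u v) + χ (I v ∧ adj G v u)))
        ≡⟨ sumFin-cong (λ u → sumFin-cong (λ v → cong (λ b → χ (u ≺ v) * (χ (I u ∧ adj G u v) + χ (I v ∧ b)))
                                                         (Graph.sym G v u))) ⟩
      sumFin² ends-in                                          ∎
      where
      open ≡-Reasoning
      as-row : ∀ u → inside I (deg G) u ≡ sumFin (λ v → χ (I u ∧ adj G u v))
      as-row u with I u
      ... | true = refl
      ... | false = sym (sumFin-zero {n})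
      diagonal : ∀ u → χ (I u ∧ adj G u u) ≡ 0
      diagonal u rewrite irrefl G u with I u
      ... | true = refl
      ... | false = refl

    independent⇒ends-in≤edge : Independent G I → ∀ u v → ends-in u v ≤ χ (u ≺ v ∧ adj G u v)
    independent⇒ends-in≤edge indep u v =
      χ-pair-≤ (u ≺ v) (I u) (I v) (adj G u v) (λ uv Iu Iv → true≢false (trans (sym uv) (indep u v Iu Iv)))

    independent⇒degree-sum≤edges : Independent G I → sumFin (inside I (deg G)) ≤ edges G
    independent⇒degree-sum≤edges indep = subst (_≤ edges G) (sym degree-sum≡sumFin²-ends-in)
      (sumFin-mono (λ u → sumFin-mono (independent⇒ends-in≤edge indep u)))

    degree-sum≡edges⇔bipartite : Independent G I → (sumFin (inside I (deg G)) ≡ edges G ⇔ BipartiteWith G I)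
    degree-sum≡edges⇔bipartite indep =
      ⇔.trans (mk⇔ (trans (sym degree-sum≡sumFin²-ends-in)) (trans degree-sum≡sumFin²-ends-in))
      (⇔.trans (sumFin²-mono-≡⇔≗ (independent⇒ends-in≤edge indep))
      (⇔.trans pointwise (⇔.sym (bipartite⇔ordered I))))
      where
      pointwise : (∀ u v → ends-in u v ≡ χ (u ≺ v ∧ adj G u v))
        ⇔ (∀ u v → (u ≺ v) ≡ true → adj G u v ≡ true → I u ≢ I v)
      pointwise = mk⇔ (λ eq u v → Equivalence.to (χ-pair-≡⇔ (u ≺ v) (I u) (I v) (adj G u v)) (eq u v))
                      (λ ne u v → Equivalence.from (χ-pair-≡⇔ (u ≺ v) (I u) (I v) (adj G u v)) (ne u v))

Tight : ∀ {n} → Graph n → (δ Δ β : ℕ) → VSet n → Set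
Tight {n} G δ Δ β I =
  (∀ v → I v ≡ false → deg G v ≡ Δ) ×
  (∀ x → I x ≡ true → deg G x ≡ n ∸ β ⊎ deg G x ≡ δ) ×
  BipartiteWith G I ×
  (δ + (n ∸ β)) * sumFin (inside I (deg G)) ≡ 2 * (δ * (n ∸ β) * β)

module ZagrebBound {n} (G : Graph n) {δ Δ β : ℕ}
  (δ≤deg : ∀ v → δ ≤ deg G v) (deg≤Δ : ∀ v → deg G v ≤ Δ)
  {I : VSet n} (indep : Independent G I) (|I|≡β : count I ≡ β) where

  m : ℕ
  m = n ∸ β

  deg² slack : Fin n → ℕ
  deg² v = deg G v ^ 2
  slack v = (deg G v ∸ δ) * (m ∸ deg G v)

  T A s S : ℕ
  T = sumFin (inside I deg²)
  A = sumFin (inside (compl I) deg²)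
  s = sumFin (inside I (deg G))
  S = sumFin (inside I slack)

  deg≤m : ∀ {x} → I x ≡ true → deg G x ≤ m
  deg≤m = independent⇒deg≤n∸|I| G indep |I|≡β

  M₁≡T+A : M₁ G ≡ T + A
  M₁≡T+A = sumFin-inside+compl I deg²

  mΔ²-as-sum : sumFin (inside (compl I) (λ _ → Δ ^ 2)) ≡ m * Δ ^ 2
  mΔ²-as-sum = trans (sumFin-inside-const (compl I) (Δ ^ 2))
                     (trans (cong (Δ ^ 2 *_) (count-compl I |I|≡β)) (*-comm (Δ ^ 2) m))

  A-terms≤ : ∀ v → inside (compl I) deg² v ≤ inside (compl I) (λ _ → Δ ^ 2) v
  A-terms≤ v with compl I v
  ... | true = ^-monoˡ-≤ 2 (deg≤Δ v)
  ... | false = z≤n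

  A≤mΔ² : A ≤ m * Δ ^ 2
  A≤mΔ² = subst (A ≤_) mΔ²-as-sum (sumFin-mono A-terms≤)

  A≡mΔ²⇔ : A ≡ m * Δ ^ 2 ⇔ (∀ v → I v ≡ false → deg G v ≡ Δ)
  A≡mΔ²⇔ = mk⇔ to from
    where
    to : A ≡ m * Δ ^ 2 → ∀ v → I v ≡ false → deg G v ≡ Δ
    to eq v Iv with sumFin-mono-≡⇒≗ A-terms≤ (trans eq (sym mΔ²-as-sum)) v
    ... | term≡ rewrite Iv = x^2≡y^2⇒x≡y term≡
    from : (∀ v → I v ≡ false → deg G v ≡ Δ) → A ≡ m * Δ ^ 2
    from outer = trans (sumFin-inside-cong (compl I) (λ v c → cong (_^ 2) (outer v (compl-true⁻¹ I v c)))) mΔ²-as-sum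

  balance : T + δ * m * β + S ≡ (δ + m) * s
  balance = begin
    T + δ * m * β + S
      ≡⟨ cong (λ x → T + x + S) (trans (cong (δ * m *_) (sym |I|≡β)) (sym (sumFin-inside-const I (δ * m)))) ⟩
    T + sumFin (inside I (λ _ → δ * m)) + S
      ≡⟨ cong (_+ S) (sumFin-+ (inside I deg²) (inside I (λ _ → δ * m))) ⟨
    sumFin (λ v → inside I deg² v + inside I (λ _ → δ * m) v) + S
      ≡⟨ sumFin-+ _ (inside I slack) ⟨
    sumFin (λ v → inside I deg² v + inside I (λ _ → δ * m) v + inside I slack v)
      ≡⟨ sumFin-cong pointwise ⟩
    sumFin (λ v → (δ + m) * inside I (deg G) v)
      ≡⟨ sumFin-*ˡ (δ + m) (inside I (deg G)) ⟩
    (δ + m) * s ∎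
    where
    open ≡-Reasoning
    pointwise : ∀ v → inside I deg² v + inside I (λ _ → δ * m) v + inside I slack v
                       ≡ (δ + m) * inside I (deg G) v
    pointwise v with I v in Iv
    ... | true = slack-identity δ m (deg G v) (δ≤deg v) (deg≤m Iv)
    ... | false = sym (*-zeroʳ (δ + m))

  S≡0⇔ : S ≡ 0 ⇔ (∀ x → I x ≡ true → deg G x ≡ m ⊎ deg G x ≡ δ)
  S≡0⇔ = mk⇔ to from
    where
    slack≡0⇔′ : ∀ {x} → I x ≡ true → (slack x ≡ 0 ⇔ (deg G x ≡ m ⊎ deg G x ≡ δ))
    slack≡0⇔′ {x} Ix = slack≡0⇔ (δ≤deg x) (deg≤m Ix)
    to : S ≡ 0 → ∀ x → I x ≡ true → deg G x ≡ m ⊎ deg G x ≡ δ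
    to eq x Ix with sumFin-mono-≡⇒≗ {f = λ _ → 0} (λ _ → z≤n) (trans (sumFin-zero {n}) (sym eq)) x
    ... | term≡ rewrite Ix = Equivalence.to (slack≡0⇔′ Ix) (sym term≡)
    from : (∀ x → I x ≡ true → deg G x ≡ m ⊎ deg G x ≡ δ) → S ≡ 0
    from inner = trans (sumFin-inside-cong I {g = λ _ → 0} (λ x Ix → Equivalence.from (slack≡0⇔′ Ix) (inner x Ix)))
                       (sumFin-inside-const I 0)

  module Arithmetic = ZagrebArithmetic {δ} {m} {β} {Δ} {edges G} {s} {T} {A} {S}
    A≤mΔ² balance (independent⇒degree-sum≤edges G I indep)

  bound : 4 * δ * m * β * M₁ G ≤ 4 * δ * m * β * (m * Δ ^ 2) + (edges G * (δ + m)) ^ 2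
  bound rewrite M₁≡T+A = Arithmetic.bound

  bound-≡⇔tight : .{{_ : NonZero δ}} .{{_ : NonZero m}} .{{_ : NonZero β}} →
    (4 * δ * m * β * M₁ G ≡ 4 * δ * m * β * (m * Δ ^ 2) + (edges G * (δ + m)) ^ 2) ⇔ Tight G δ Δ β I
  bound-≡⇔tight rewrite M₁≡T+A =
    ⇔.trans (Arithmetic.bound-≡⇔)
            (A≡mΔ²⇔ ×-⇔ S≡0⇔ ×-⇔ degree-sum≡edges⇔bipartite G I indep ×-⇔ ⇔.refl)

module _ {n} (G : Graph n) {δ Δ β : ℕ} where

  tight⇒extremal : (∀ v → δ ≤ deg G v) → ∀ {I} → Independent G I → count I ≡ β → 0 < β →
    Tight G δ Δ β I → IsCompleteBipartite G β (n ∸ β) ⊎ SecondExtremal G δ Δ β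
  tight⇒extremal δ≤deg {I} indep |I|≡β β>0 (outer , inner , bip , balanced) with δ ≟ n ∸ β
  ... | yes δ≡m = inj₁ (I , |I|≡β , count-compl I |I|≡β , λ u v → bip u v , cross u v)
    where
    full : ∀ {x} → I x ≡ true → ∀ v → I v ≡ false → adj G x v ≡ true
    full {x} Ix v Iv = count-mono-≡⇒⊇ (independent⇒neighbours⊆compl G indep Ix) deg≡ v (compl-true I v Iv)
      where
      deg≡ : deg G x ≡ count (compl I)
      deg≡ = trans (⊎.[ id , (λ d≡δ → trans d≡δ δ≡m) ] (inner x Ix)) (sym (count-compl I |I|≡β))
    cross : ∀ u v → I u ≢ I v → adj G u v ≡ true
    cross u v Iu≢Iv with I u in Iu | I v in Iv
    ... | true | true = ⊥-elim (Iu≢Iv refl)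
    ... | false | false = ⊥-elim (Iu≢Iv refl)
    ... | true | false = full Iu v Iv
    ... | false | true = trans (Graph.sym G u v) (full Iv u Iu)
  ... | no δ≢m = inj₂ (I , bip , |I|≡β , δ<m , outer , inner , balance⇒counts m≢δ P+Q≡β balanced′)
    where
    m≢δ : n ∸ β ≢ δ
    m≢δ = δ≢m ∘ sym
    δ<m : δ < n ∸ β
    δ<m = let x , Ix = count-witness I (subst (0 <_) (sym |I|≡β) β>0) in
      ≤∧≢⇒< (≤-trans (δ≤deg x) (independent⇒deg≤n∸|I| G indep |I|≡β Ix)) δ≢m
    P Q : ℕ
    P = count (λ x → I x ∧ (deg G x ≡ᵇ (n ∸ β)))
    Q = count (λ x → I x ∧ (deg G x ≡ᵇ δ))
    split : ∀ h → sumFin (inside I (λ x → h (deg G x))) ≡ h (n ∸ β) * P + h δ * Q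
    split = sumFin-inside-two-valued I (deg G) m≢δ inner
    P+Q≡β : P + Q ≡ β
    P+Q≡β = trans (sym (cong₂ _+_ (*-identityˡ P) (*-identityˡ Q))) (trans (sym (split (λ _ → 1))) |I|≡β)
    balanced′ : (δ + (n ∸ β)) * ((n ∸ β) * P + δ * Q) ≡ 2 * (δ * (n ∸ β) * β)
    balanced′ = trans (cong ((δ + (n ∸ β)) *_) (sym (split (λ d → d)))) balanced

  degree-extremes : IsMinDegree G δ → IsMaxDegree G Δ → ∀ {a b} → a ≤ b →
    (∀ v → deg G v ≡ a ⊎ deg G v ≡ b) → (∃ λ x → deg G x ≡ a) → (∃ λ y → deg G y ≡ b) → δ ≡ a × Δ ≡ b
  degree-extremes (δ≤deg , w , dw≡δ) (deg≤Δ , z , dz≡Δ) {a} {b} a≤b two-valued (x , dx≡a) (y , dy≡b) =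
    ≤-antisym (subst (δ ≤_) dx≡a (δ≤deg x)) (subst (a ≤_) dw≡δ (a≤deg w)) ,
    ≤-antisym (subst (_≤ b) dz≡Δ (deg≤b z)) (subst (_≤ Δ) dy≡b (deg≤Δ y))
    where
    a≤deg : ∀ v → a ≤ deg G v
    a≤deg v = ⊎.[ ≤-reflexive ∘ sym , (λ d≡b → ≤-trans a≤b (≤-reflexive (sym d≡b))) ] (two-valued v)
    deg≤b : ∀ v → deg G v ≤ b
    deg≤b v = ⊎.[ (λ d≡a → ≤-trans (≤-reflexive d≡a) a≤b) , ≤-reflexive ] (two-valued v)

  complete-bipartite-neighbour : ∀ {a b} ((J , _) : IsCompleteBipartite G a b) → ∀ x v →
    adj G x v ≡ (if J x then compl J v else J v)
  complete-bipartite-neighbour (J , _ , _ , adjJ) x v with adj G x v in xv | J x in Jx | J v in Jv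
  ... | true | true | true = ⊥-elim (proj₁ (adjJ x v) xv (trans Jx (sym Jv)))
  ... | true | false | false = ⊥-elim (proj₁ (adjJ x v) xv (trans Jx (sym Jv)))
  ... | false | true | false =
    ⊥-elim (true≢false (trans (sym (proj₂ (adjJ x v) (true-false⇒≢ Jx Jv))) xv))
  ... | false | false | true =
    ⊥-elim (true≢false (trans (sym (proj₂ (adjJ x v) (true-false⇒≢ Jv Jx ∘ sym))) xv))
  ... | true | true | false = refl
  ... | true | false | true = refl
  ... | false | true | true = refl
  ... | false | false | false = refl

  complete-bipartite-degree : ∀ {a b} (K@(J , _) : IsCompleteBipartite G a b) → ∀ x →
    deg G x ≡ (if J x then b else a)
  complete-bipartite-degree {a} {b} K@(J , |J|≡a , |compl-J|≡b , _) x =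
    trans (sumFin-cong (λ v → cong χ (complete-bipartite-neighbour K x v))) (side-size (J x))
    where
    side-size : ∀ c → count (λ v → if c then compl J v else J v) ≡ (if c then b else a)
    side-size true = |compl-J|≡b
    side-size false = |J|≡a

  complete-bipartite⇒tight : IsMinDegree G δ → 1 ≤ δ → IsMaxDegree G Δ → IsIndependenceNumber G β →
    ((J , _) : IsCompleteBipartite G β (n ∸ β)) → Tight G δ Δ β J
  complete-bipartite⇒tight minδ@(δ≤deg , w , _) δ≥1 maxΔ indβ@(_ , maximal) K@(J , |J|≡β , |compl-J|≡m , adjJ) =
    (λ v Jv → trans (deg-outside Jv) (sym (proj₂ extremes))) , (λ x Jx → inj₁ (deg-inside Jx)) , bip , balanced
    where
    bip : BipartiteWith G J
    bip u v = proj₁ (adjJ u v)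
    deg-inside : ∀ {x} → J x ≡ true → deg G x ≡ n ∸ β
    deg-inside {x} Jx = trans (complete-bipartite-degree K x) (cong (λ c → if c then n ∸ β else β) Jx)
    deg-outside : ∀ {x} → J x ≡ false → deg G x ≡ β
    deg-outside {x} Jx = trans (complete-bipartite-degree K x) (cong (λ c → if c then n ∸ β else β) Jx)
    deg-two-valued : ∀ v → deg G v ≡ n ∸ β ⊎ deg G v ≡ β
    deg-two-valued v with J v in Jv
    ... | true = inj₁ (deg-inside Jv)
    ... | false = inj₂ (deg-outside Jv)
    m≤β : n ∸ β ≤ β
    m≤β = subst (_≤ β) |compl-J|≡m (maximal (compl J) (λ u v Ju Jv →
      bipartite⇒same-side-nonadjacent G bip u v (trans (compl-true⁻¹ J u Ju) (sym (compl-true⁻¹ J v Jv)))))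
    inside-witness : ∃ λ x → J x ≡ true
    inside-witness = count-witness J (subst (0 <_) (sym |J|≡β) (independence-number-positive G indβ w))
    outside-witness : ∃ λ y → compl J y ≡ true
    outside-witness = count-witness (compl J)
      (independent⇒count-compl-positive G (bipartite⇒independent G bip) w (≤-trans δ≥1 (δ≤deg w)))
    extremes : δ ≡ n ∸ β × Δ ≡ β
    extremes = degree-extremes minδ maxΔ m≤β deg-two-valued
      (map₂ deg-inside inside-witness) (map₂ (λ {y} c → deg-outside (compl-true⁻¹ J y c)) outside-witness)
    balanced : (δ + (n ∸ β)) * sumFin (inside J (deg G)) ≡ 2 * (δ * (n ∸ β) * β)
    balanced rewrite proj₁ extremes = begin
      (n ∸ β + (n ∸ β)) * sumFin (inside J (deg G))   ≡⟨ cong ((n ∸ β + (n ∸ β)) *_) degree-sum ⟩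
      (n ∸ β + (n ∸ β)) * ((n ∸ β) * β)              ≡⟨ identity (n ∸ β) β ⟩
      2 * ((n ∸ β) * (n ∸ β) * β)                    ∎
      where
      open ≡-Reasoning
      degree-sum : sumFin (inside J (deg G)) ≡ (n ∸ β) * β
      degree-sum = trans (sumFin-inside-cong J (λ _ → deg-inside)) (trans (sumFin-inside-const J (n ∸ β)) (cong ((n ∸ β) *_) |J|≡β))
      identity : ∀ m β → (m + m) * (m * β) ≡ 2 * (m * m * β)
      identity = solve-∀

  second-extremal⇒tight : ((J , _) : SecondExtremal G δ Δ β) → Tight G δ Δ β J
  second-extremal⇒tight (J , bip , _ , δ<m , outer , inner , P-count , Q-count) =
    outer , inner , bip , trans (cong ((δ + (n ∸ β)) *_) degree-sum) (counts⇒balance {δ} {n ∸ β} P-count Q-count)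
    where
    degree-sum : sumFin (inside J (deg G))
      ≡ (n ∸ β) * count (λ x → J x ∧ (deg G x ≡ᵇ (n ∸ β))) + δ * count (λ x → J x ∧ (deg G x ≡ᵇ δ))
    degree-sum = sumFin-inside-two-valued J (deg G) (λ m≡δ → <-irrefl (sym m≡δ) δ<m) inner (λ d → d)

  extremal⇒tight : IsMinDegree G δ → 1 ≤ δ → IsMaxDegree G Δ → IsIndependenceNumber G β →
    IsCompleteBipartite G β (n ∸ β) ⊎ SecondExtremal G δ Δ β →
    ∃ λ J → Independent G J × count J ≡ β × Tight G δ Δ β J
  extremal⇒tight minδ δ≥1 maxΔ indβ (inj₁ K@(J , |J|≡β , _ , adjJ)) =
    J , bipartite⇒independent G (λ u v → proj₁ (adjJ u v)) , |J|≡β , complete-bipartite⇒tight minδ δ≥1 maxΔ indβ K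
  extremal⇒tight _ _ _ _ (inj₂ E@(J , bip , |J|≡β , _)) =
    J , bipartite⇒independent G bip , |J|≡β , second-extremal⇒tight E

theorem3 : ∀ {n} (G : Graph n) (δ Δ β : ℕ) →
    IsMinDegree G δ → 1 ≤ δ → IsMaxDegree G Δ → IsIndependenceNumber G β →
    (4 * δ * (n ∸ β) * β * M₁ G
       ≤ 4 * δ * (n ∸ β) * β * ((n ∸ β) * Δ ^ 2) + (edges G * (δ + (n ∸ β))) ^ 2)
    × ((4 * δ * (n ∸ β) * β * M₁ G
       ≡ 4 * δ * (n ∸ β) * β * ((n ∸ β) * Δ ^ 2) + (edges G * (δ + (n ∸ β))) ^ 2)
       ⇔ (IsCompleteBipartite G β (n ∸ β) ⊎ SecondExtremal G δ Δ β))
theorem3 {n} G δ Δ β minδ@(δ≤deg , w , _) δ≥1 maxΔ@(deg≤Δ , _) indβ@((I , indep , |I|≡β) , _) =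
  Bound.bound indep |I|≡β ,
  mk⇔ (tight⇒extremal G δ≤deg indep |I|≡β β>0 ∘ Equivalence.to (Bound.bound-≡⇔tight indep |I|≡β))
      (λ extremal → let J , J-indep , |J|≡β , tight = extremal⇒tight G minδ δ≥1 maxΔ indβ extremal in
                    Equivalence.from (Bound.bound-≡⇔tight J-indep |J|≡β) tight)
  where
  module Bound = ZagrebBound G δ≤deg deg≤Δ
  β>0 : 0 < β
  β>0 = independence-number-positive G indβ w
  m>0 : 0 < n ∸ β
  m>0 = subst (0 <_) (count-compl I |I|≡β)
    (independent⇒count-compl-positive G indep w (≤-trans δ≥1 (δ≤deg w)))
  instance
    δ≢0 : NonZero δ
    δ≢0 = >-nonZero δ≥1
    m≢0 : NonZero (n ∸ β)
    m≢0 = >-nonZero m>0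
    β≢0 : NonZero β
    β≢0 = >-nonZero β>0
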